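{- Let $p$ be an odd prime with $p \equiv 2 \pmod 3$, and let $c = 0$. For a positive integer $n$, let $M_n = [m_{ij}]_{1 \le i,j \le n}$ be the $n \times n$ matrix with entries $m_{ij} = \left[ \frac{j-i+c}{p} \right]$. Then for every $n$ with $1 \le n \le p$, $\det(M_n) = (-1)^{n-1}(n-1)$.
   Context: For an odd prime $p$ and an integer $a$, the cubic residue symbol is defined by $\left[ \frac{a}{p} \right] = 1$ if $a \not\equiv 0 \pmod p$ and $x^3 \equiv a \pmod p$ has an integer solution; $\left[ \frac{a}{p} \right] = -1$ if $x^3 \equiv a \pmod p$ has no integer solution; and $\left[ \frac{a}{p} \right] = 0$ if $a \equiv 0 \pmod p$. -}

module Defs where

open import Data.Nat using (ℕ; zero; suc)
open import Data.Fin using (Fin; zero; suc; toℕ; punchIn)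
open import Data.Integer using (ℤ; +_; -_; _+_; _-_; _*_; _^_; 0ℤ; 1ℤ)
open import Data.Integer.Divisibility using (_∣_)
open import Data.Product using (∃; _×_)
open import Data.Sum using (_⊎_)
open import Relation.Nullary using (¬_)
open import Relation.Binary.PropositionalEquality using (_≡_)

CubeSolvable : ℕ → ℤ → Set
CubeSolvable p a = ∃ λ (x : ℤ) → (+ p) ∣ (x ^ 3 - a)

-- CubicSymbol p a v  means  [a/p] = v, following the definition of the paper:
--   v = 1  if a ≢ 0 (mod p) and x^3 ≡ a (mod p) is solvable,
--   v = -1 if x^3 ≡ a (mod p) has no integer solution,
--   v = 0  if a ≡ 0 (mod p).
CubicSymbol : ℕ → ℤ → ℤ → Set
CubicSymbol p a v =
    ((¬ ((+ p) ∣ a)) × CubeSolvable p a × v ≡ 1ℤ)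
  ⊎ ((¬ CubeSolvable p a) × v ≡ - 1ℤ)
  ⊎ (((+ p) ∣ a) × v ≡ 0ℤ)

∑ : (n : ℕ) → (Fin n → ℤ) → ℤ
∑ zero    f = 0ℤ
∑ (suc n) f = f zero + ∑ n (λ i → f (suc i))

det : (n : ℕ) → (Fin n → Fin n → ℤ) → ℤ
det zero    M = 1ℤ
det (suc n) M =
  ∑ (suc n) (λ j → ((- 1ℤ) ^ toℕ j) * M zero j * det n (λ i k → M (suc i) (punchIn j k)))

module Submission where

-- Writing p = 3t + 2, Fermat's little theorem gives (a^(2t+1))^3 = a^(p-1)·a^p ≡ a (mod p),
-- so every integer is a cube modulo p.  Hence [a/p] is 0 when p ∣ a and 1 otherwise, and since
-- all indices are below p the matrix is J - I (ones off the diagonal, zeros on it).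
-- The theorem identifies its matrix with J - I entrywise and applies part 3.

open import Defs
open import Data.Nat using (ℕ; _≤_; _∸_; _%_)
open import Data.Nat.Primality using (Prime)
open import Data.Fin using (Fin; toℕ)
open import Data.Integer using (ℤ; +_; -_; _+_; _-_; _*_; _^_; 0ℤ; 1ℤ)
open import Relation.Binary.PropositionalEquality using (_≡_)

open import Data.Nat as ℕ using (zero; suc; z≤n; s≤s)
import Data.Nat.Properties as ℕ
import Data.Nat.Divisibility as ℕ
import Data.Nat.Tactic.RingSolver as ℕ-Solver
open import Data.Nat.DivMod using (m≡m%n+[m/n]*n)
open import Data.Nat.Primality using (euclidsLemma)
open import Data.Nat.Combinatorics using (_C_; nCn≡1; nC1≡n; nCk+nC[k+1]≡[n+1]C[k+1])
open import Data.Fin using (zero; suc; punchIn; punchOut; inject₁; fromℕ; fromℕ<)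
open import Data.Fin.Properties
  using (toℕ<n; toℕ-fromℕ; toℕ-fromℕ<; toℕ-inject₁; toℕ-injective; suc-injective;
         punchInᵢ≢i; punchIn-punchOut; punchIn-injective)
  renaming (_≟_ to _≟ᶠ_)
open import Data.Integer using (∣_∣; -[1+_])
import Data.Integer
import Data.Integer.Properties as ℤ
import Data.Integer.Divisibility as Unsigned
open import Data.Integer.Divisibility.Signed
  using (_∣_; divides; ∣ᵤ⇒∣; ∣⇒∣ᵤ; ∣m∣n⇒∣m+n; ∣m⇒∣-m; ∣m⇒∣m*n; ∣n⇒∣m*n)
open import Data.Integer.Tactic.RingSolver using (solve-∀)
import Algebra.Properties.CommutativeSemiring.Binomial as Binomial
import Algebra.Definitions.RawSemiring as RawSemiring
open import Data.Empty using (⊥-elim)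
open import Data.Product using (∃; _×_; _,_)
open import Data.Sum using (_⊎_; inj₁; inj₂)
open import Relation.Nullary using (¬_; yes; no)
open import Relation.Binary.Definitions using (tri<; tri≈; tri>)
open import Relation.Binary.PropositionalEquality using (_≢_; refl; sym; trans; cong; cong₂; subst; module ≡-Reasoning)

-- the library's binomial theorem, over ℤ; it is phrased with the semiring's own power _^ˢ_
-- and natural-number multiple _×ˢ_
open Binomial ℤ.+-*-commutativeSemiring using (binomialTerm) renaming (theorem to binomialTheorem)
open import Algebra.Properties.Monoid.Sum ℤ.+-0-monoid using (sum; sum-init-last)
open import Algebra.Definitions.RawMonoid Data.Integer.+-0-rawMonoid using () renaming (_×_ to _×ˢ_)
open RawSemiring Data.Integer.+-*-rawSemiring using () renaming (_^_ to _^ˢ_)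

C-absorption : ∀ n k → suc k ℕ.* (suc n C suc k) ≡ suc n ℕ.* (n C k)
C-absorption zero    zero    = refl
C-absorption zero    (suc k) = ℕ.*-zeroʳ (suc (suc k))
C-absorption (suc n) zero    = trans (ℕ.+-identityʳ _) (trans (nC1≡n (suc (suc n))) (sym (ℕ.*-identityʳ _)))
C-absorption (suc n) (suc k) = begin
  suc (suc k) ℕ.* (suc (suc n) C suc (suc k))
    ≡⟨ cong (suc (suc k) ℕ.*_) (sym (nCk+nC[k+1]≡[n+1]C[k+1] (suc n) (suc k))) ⟩
  suc (suc k) ℕ.* (x ℕ.+ y)
    ≡⟨ ℕ.*-distribˡ-+ (suc (suc k)) x y ⟩
  (x ℕ.+ suc k ℕ.* x) ℕ.+ suc (suc k) ℕ.* y
    ≡⟨ cong₂ (λ u v → (x ℕ.+ u) ℕ.+ v) (C-absorption n k) (C-absorption n (suc k)) ⟩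
  (x ℕ.+ suc n ℕ.* (n C k)) ℕ.+ suc n ℕ.* (n C suc k)
    ≡⟨ ℕ.+-assoc x _ _ ⟩
  x ℕ.+ (suc n ℕ.* (n C k) ℕ.+ suc n ℕ.* (n C suc k))
    ≡⟨ cong (x ℕ.+_) (sym (ℕ.*-distribˡ-+ (suc n) (n C k) (n C suc k))) ⟩
  x ℕ.+ suc n ℕ.* (n C k ℕ.+ n C suc k)
    ≡⟨ cong (λ z → x ℕ.+ suc n ℕ.* z) (nCk+nC[k+1]≡[n+1]C[k+1] n k) ⟩
  suc (suc n) ℕ.* x ∎
  where
  open ≡-Reasoning
  x = suc n C suc k
  y = suc n C suc (suc k)

prime∣C : ∀ {p k} → Prime p → 0 ℕ.< k → k ℕ.< p → p ℕ.∣ p C k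
prime∣C {suc q} {suc j} p-prime _ j<p
  with euclidsLemma (suc j) (suc q C suc j) p-prime (ℕ.divides (q C j) (trans (C-absorption q j) (ℕ.*-comm (suc q) (q C j))))
... | inj₁ p∣k = ⊥-elim (ℕ.<⇒≱ j<p (ℕ.∣⇒≤ p∣k))
... | inj₂ p∣C = p∣C

^ˢ≡^ : ∀ x n → x ^ˢ n ≡ x ^ n
^ˢ≡^ x zero    = refl
^ˢ≡^ x (suc n) = cong (x *_) (^ˢ≡^ x n)

×ˢ≡* : ∀ n x → n ×ˢ x ≡ + n * x
×ˢ≡* zero    x = refl
×ˢ≡* (suc n) x = trans (cong (λ z → x + z) (×ˢ≡* n x)) (sym (ℤ.suc-* (+ n) x))

∣-zero : ∀ {d} → d ∣ 0ℤ
∣-zero = divides 0ℤ refl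

∣-sum : ∀ {d n} (f : Fin n → ℤ) → (∀ k → d ∣ f k) → d ∣ sum f
∣-sum {n = zero}  f d∣f = ∣-zero
∣-sum {n = suc n} f d∣f = ∣m∣n⇒∣m+n (d∣f zero) (∣-sum (λ k → f (suc k)) (λ k → d∣f (suc k)))

∣-sum-inner : ∀ {d} m (t : Fin (suc (suc m)) → ℤ) → (∀ k → d ∣ t (suc (inject₁ k))) →
  d ∣ sum t - (t zero + t (fromℕ (suc m)))
∣-sum-inner m t d∣inner = subst (_ ∣_) ends (∣-sum (λ k → t (suc (inject₁ k))) d∣inner)
  where
  inner = sum (λ k → t (suc (inject₁ k)))
  cancel : ∀ a b c → c ≡ (a + (c + b)) - (a + b)
  cancel = solve-∀
  ends : inner ≡ sum t - (t zero + t (fromℕ (suc m)))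
  ends = trans (cancel (t zero) (t (fromℕ (suc m))) inner)
               (cong (λ s → (t zero + s) - (t zero + t (fromℕ (suc m)))) (sym (sum-init-last (λ k → t (suc k)))))

frobenius : ∀ {p} → Prime p → ∀ x → + p ∣ (x + 1ℤ) ^ p - (1ℤ + x ^ p)
frobenius {suc (suc m)} p-prime x =
  subst (+ p ∣_) (cong₂ (λ s e → s - e) expansion (cong₂ _+_ firstTerm lastTerm)) (∣-sum-inner (suc m) t inner)
  where
  p = suc (suc m)
  g : ℕ → ℤ
  g j = (p C j) ×ˢ (x ^ˢ j * 1ℤ ^ˢ (p ℕ.∸ j))
  t : Fin (suc p) → ℤ
  t = binomialTerm x 1ℤ p
  one^ : ∀ n → 1ℤ ^ˢ n ≡ 1ℤ
  one^ n = trans (^ˢ≡^ 1ℤ n) (ℤ.^-zeroˡ n)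
  expansion : sum t ≡ (x + 1ℤ) ^ p
  expansion = trans (sym (binomialTheorem p x 1ℤ)) (^ˢ≡^ (x + 1ℤ) p)
  firstTerm : t zero ≡ 1ℤ
  firstTerm = cong (λ y → 1ℤ * y + 0ℤ) (one^ p)
  lastTerm : t (fromℕ p) ≡ x ^ p
  lastTerm = begin
    g (toℕ (fromℕ p))                    ≡⟨ cong g (toℕ-fromℕ p) ⟩
    (p C p) ×ˢ (x ^ˢ p * 1ℤ ^ˢ (p ℕ.∸ p)) ≡⟨ cong₂ (λ c e → c ×ˢ (x ^ˢ p * 1ℤ ^ˢ e)) (nCn≡1 p) (ℕ.n∸n≡0 p) ⟩
    x ^ˢ p * 1ℤ + 0ℤ                    ≡⟨ trans (ℤ.+-identityʳ _) (ℤ.*-identityʳ _) ⟩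
    x ^ˢ p                              ≡⟨ ^ˢ≡^ x p ⟩
    x ^ p                               ∎
    where open ≡-Reasoning
  inner : ∀ k → + p ∣ t (suc (inject₁ k))
  inner k = subst (+ p ∣_) (sym (trans (cong (λ j → g (suc j)) (toℕ-inject₁ k)) (×ˢ≡* (p C j) _)))
                  (∣m⇒∣m*n (x ^ˢ j * 1ℤ ^ˢ (p ℕ.∸ j)) (∣ᵤ⇒∣ {+ p} {+ (p C j)} (prime∣C p-prime (s≤s z≤n) (s≤s (toℕ<n k)))))
    where j = suc (toℕ k)

-- Fermat's little theorem for natural numbers, by induction using Frobenius
fermat : ∀ {p} → Prime p → ∀ n → + p ∣ (+ n) ^ p - + n
fermat {suc q} p-prime zero    = ∣-zero
fermat {p}     p-prime (suc n) = subst (+ p ∣_) (sym split) (∣m∣n⇒∣m+n (frobenius p-prime (+ n)) (fermat p-prime n))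
  where
  regroup : ∀ A B y → A - (y + 1ℤ) ≡ (A - (1ℤ + B)) + (B - y)
  regroup = solve-∀
  split : (+ suc n) ^ p - + suc n ≡ ((+ n + 1ℤ) ^ p - (1ℤ + (+ n) ^ p)) + ((+ n) ^ p - + n)
  split = trans (cong (λ y → y ^ p - y) (ℤ.+-comm 1ℤ (+ n))) (regroup ((+ n + 1ℤ) ^ p) ((+ n) ^ p) (+ n))

-- If p = 3t + 2 is prime, every integer has a cube root modulo p:
-- for a natural number a, a^(2t+1) cubes to a^(p-1)·a^p ≡ a.
cube-root-ℕ : ∀ {p} → Prime p → p ℕ.% 3 ≡ 2 → ∀ n → ∃ λ r → + p ∣ r ^ 3 - + n
cube-root-ℕ {p} p-prime p≡2 n = a ^ e , subst (+ p ∣_) (sym cube-minus-a) divisible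
  where
  a = + n
  t = p ℕ./ 3
  q = 1 ℕ.+ t ℕ.* 3
  e = 1 ℕ.+ 2 ℕ.* t
  p≡1+q : p ≡ suc q
  p≡1+q = trans (m≡m%n+[m/n]*n p 3) (cong (ℕ._+ t ℕ.* 3) p≡2)
  3e≡q+p : e ℕ.* 3 ≡ q ℕ.+ p
  3e≡q+p = trans (ℕ-identity t) (cong (q ℕ.+_) (sym p≡1+q))
    where ℕ-identity : ∀ t → (1 ℕ.+ 2 ℕ.* t) ℕ.* 3 ≡ (1 ℕ.+ t ℕ.* 3) ℕ.+ suc (1 ℕ.+ t ℕ.* 3)
          ℕ-identity = ℕ-Solver.solve-∀
  regroup : ∀ w P a → w * P - a ≡ w * (P - a) + (a * w - a)
  regroup = solve-∀
  cube-minus-a : (a ^ e) ^ 3 - a ≡ a ^ q * (a ^ p - a) + (a ^ p - a)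
  cube-minus-a = begin
    (a ^ e) ^ 3 - a          ≡⟨ cong (_- a) (trans (ℤ.^-*-assoc a e 3) (cong (a ^_) 3e≡q+p)) ⟩
    a ^ (q ℕ.+ p) - a        ≡⟨ cong (_- a) (ℤ.^-distribˡ-+-* a q p) ⟩
    a ^ q * a ^ p - a        ≡⟨ regroup (a ^ q) (a ^ p) a ⟩
    a ^ q * (a ^ p - a) + (a ^ suc q - a) ≡⟨ cong (λ k → a ^ q * (a ^ p - a) + (a ^ k - a)) (sym p≡1+q) ⟩
    a ^ q * (a ^ p - a) + (a ^ p - a) ∎
    where open ≡-Reasoning
  divisible : + p ∣ a ^ q * (a ^ p - a) + (a ^ p - a)
  divisible = ∣m∣n⇒∣m+n (∣n⇒∣m*n (a ^ q) (fermat p-prime n)) (fermat p-prime n)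

-- every integer is a cube modulo p; a negative a = -b has the negated root of b
cube-root : ∀ {p} → Prime p → p ℕ.% 3 ≡ 2 → ∀ a → ∃ λ r → + p ∣ r ^ 3 - a
cube-root p-prime p≡2 (+ n)      = cube-root-ℕ p-prime p≡2 n
cube-root p-prime p≡2 -[1+ n ] with cube-root-ℕ p-prime p≡2 (suc n)
... | r , p∣r³-b = - r , subst (_ ∣_) (negate-cube r (+ suc n)) (∣m⇒∣-m p∣r³-b)
  where negate-cube : ∀ r x → - (r * (r * (r * 1ℤ)) - x) ≡ (- r) * ((- r) * ((- r) * 1ℤ)) - (- x)
        negate-cube = solve-∀

symbol-of-multiple : ∀ {p a v} → + p Unsigned.∣ a → CubicSymbol p a v → v ≡ 0ℤ
symbol-of-multiple p∣a (inj₁ (p∤a , _))          = ⊥-elim (p∤a p∣a)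
symbol-of-multiple {p} {a} p∣a (inj₂ (inj₁ (noRoot , _))) = ⊥-elim (noRoot (0ℤ , p∣0³-a))
  where p∣0³-a : + p Unsigned.∣ (0ℤ ^ 3 - a)
        p∣0³-a = subst (λ z → p ℕ.∣ ∣ z ∣) (sym (ℤ.+-identityˡ (- a))) (subst (p ℕ.∣_) (sym (ℤ.∣-i∣≡∣i∣ a)) p∣a)
symbol-of-multiple p∣a (inj₂ (inj₂ (_ , v≡0)))   = v≡0

symbol-of-unit : ∀ {p a v} → (∀ b → CubeSolvable p b) → ¬ + p Unsigned.∣ a → CubicSymbol p a v → v ≡ 1ℤ
symbol-of-unit all-cubes p∤a (inj₁ (_ , _ , v≡1))          = v≡1
symbol-of-unit all-cubes p∤a (inj₂ (inj₁ (noRoot , _)))    = ⊥-elim (noRoot (all-cubes _))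
symbol-of-unit all-cubes p∤a (inj₂ (inj₂ (p∣a , _)))       = ⊥-elim (p∤a p∣a)

below-not-multiple : ∀ {p d} → 0 ℕ.< d → d ℕ.< p → ¬ p ℕ.∣ d
below-not-multiple {d = suc _} _ d<p p∣d = ℕ.<⇒≱ d<p (ℕ.∣⇒≤ p∣d)

distinct-incongruent : ∀ {p x y} → x ℕ.< p → y ℕ.< p → x ≢ y → ¬ + p Unsigned.∣ (+ y - + x)
distinct-incongruent {p} {x} {y} x<p y<p x≢y p∣y-x with ℕ.<-cmp x y
... | tri< x<y _ _ = below-not-multiple (ℕ.m<n⇒0<n∸m x<y) (ℕ.≤-<-trans (ℕ.m∸n≤m y x) y<p)
      (subst (p ℕ.∣_) (trans (cong ∣_∣ (ℤ.[+m]-[+n]≡m⊖n y x)) (trans (ℤ.∣m⊖n∣≡∣n⊖m∣ y x) (ℤ.∣⊖∣-< x<y))) p∣y-x)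
... | tri≈ _ x≡y _ = x≢y x≡y
... | tri> _ _ y<x = below-not-multiple (ℕ.m<n⇒0<n∸m y<x) (ℕ.≤-<-trans (ℕ.m∸n≤m x y) x<p)
      (subst (p ℕ.∣_) (trans (cong ∣_∣ (ℤ.[+m]-[+n]≡m⊖n y x)) (ℤ.∣⊖∣-< y<x)) p∣y-x)

Matrix : ℕ → Set
Matrix n = Fin n → Fin n → ℤ

_≐_ : ∀ {n} → Matrix n → Matrix n → Set
M ≐ N = ∀ i k → M i k ≡ N i k

sign : ∀ {n} → Fin n → ℤ
sign j = (- 1ℤ) ^ toℕ j

minor : ∀ {n} → Fin (suc n) → Matrix (suc n) → Matrix n
minor j M i k = M (suc i) (punchIn j k)

∑-cong : ∀ n {f g : Fin n → ℤ} → (∀ i → f i ≡ g i) → ∑ n f ≡ ∑ n g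
∑-cong zero    f≡g = refl
∑-cong (suc n) f≡g = cong₂ _+_ (f≡g zero) (∑-cong n (λ i → f≡g (suc i)))

∑-zero : ∀ n (f : Fin n → ℤ) → (∀ i → f i ≡ 0ℤ) → ∑ n f ≡ 0ℤ
∑-zero zero    f f≡0 = refl
∑-zero (suc n) f f≡0 = cong₂ _+_ (f≡0 zero) (∑-zero n (λ i → f (suc i)) (λ i → f≡0 (suc i)))

∑-linear : ∀ n (f g : Fin n → ℤ) l → ∑ n (λ i → f i + l * g i) ≡ ∑ n f + l * ∑ n g
∑-linear zero    f g l = sym (trans (ℤ.+-identityˡ (l * 0ℤ)) (ℤ.*-zeroʳ l))
∑-linear (suc n) f g l = trans (cong (λ s → f zero + l * g zero + s) (∑-linear n (λ i → f (suc i)) (λ i → g (suc i)) l))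
                               (regroup (f zero) (g zero) (∑ n (λ i → f (suc i))) (∑ n (λ i → g (suc i))) l)
  where regroup : ∀ a b F G l → (a + l * b) + (F + l * G) ≡ (a + F) + l * (b + G)
        regroup = solve-∀

term-linear-in-entry : ∀ σ a b d l → σ * (a + l * b) * d ≡ σ * a * d + l * (σ * b * d)
term-linear-in-entry = solve-∀

det-cong : ∀ n {M N : Matrix n} → M ≐ N → det n M ≡ det n N
det-cong zero    M≐N = refl
det-cong (suc n) M≐N = ∑-cong (suc n) λ j →
  cong₂ (λ x d → sign j * x * d) (M≐N zero j) (det-cong n (λ i k → M≐N (suc i) (punchIn j k)))

_≟_ : ∀ {n} (x y : Fin n) → x ≡ y ⊎ x ≢ y
x ≟ y with x ≟ᶠ y
... | yes x≡y = inj₁ x≡y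
... | no  x≢y = inj₂ x≢y

column : ∀ {n} → Matrix n → Fin n → Fin n → ℤ
column M c i = M i c

setCol : ∀ {n} → Matrix n → Fin n → (Fin n → ℤ) → Matrix n
setCol M c v i k with k ≟ᶠ c
... | yes _ = v i
... | no  _ = M i k

setCol-at : ∀ {n} (M : Matrix n) c v i → setCol M c v i c ≡ v i
setCol-at M c v i with c ≟ᶠ c
... | yes _   = refl
... | no  c≢c = ⊥-elim (c≢c refl)

setCol-off : ∀ {n} (M : Matrix n) c v i {k} → k ≢ c → setCol M c v i k ≡ M i k
setCol-off M c v i {k} k≢c with k ≟ᶠ c
... | yes k≡c = ⊥-elim (k≢c k≡c)
... | no  _   = refl

setCol-self : ∀ {n} (M : Matrix n) c → setCol M c (column M c) ≐ M
setCol-self M c i k with k ≟ c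
... | inj₁ refl = setCol-at M k (column M k) i
... | inj₂ k≢c  = setCol-off M c (column M c) i k≢c

setCol-cong : ∀ {n} (M : Matrix n) c {v w : Fin n → ℤ} → (∀ i → v i ≡ w i) → setCol M c v ≐ setCol M c w
setCol-cong M c v≡w i k with k ≟ c
... | inj₁ refl = trans (setCol-at M k _ i) (trans (v≡w i) (sym (setCol-at M k _ i)))
... | inj₂ k≢c  = trans (setCol-off M c _ i k≢c) (sym (setCol-off M c _ i k≢c))

setCol-comm : ∀ {n} (M : Matrix n) {a b} u v → a ≢ b → setCol (setCol M a u) b v ≐ setCol (setCol M b v) a u
setCol-comm M {a} {b} u v a≢b i k with k ≟ a | k ≟ b
... | inj₁ refl | inj₁ refl = ⊥-elim (a≢b refl)
... | inj₁ refl | inj₂ k≢b  = trans (setCol-off _ b v i k≢b) (trans (setCol-at M k u i) (sym (setCol-at _ k u i)))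
... | inj₂ k≢a  | inj₁ refl = trans (setCol-at _ k v i) (sym (trans (setCol-off _ a u i k≢a) (setCol-at M k v i)))
... | inj₂ k≢a  | inj₂ k≢b  = trans (setCol-off _ b v i k≢b) (trans (setCol-off M a u i k≢a)
                             (sym (trans (setCol-off _ a u i k≢a) (setCol-off M b v i k≢b))))

minor-setCol-at : ∀ {n} (M : Matrix (suc n)) c v → minor c (setCol M c v) ≐ minor c M
minor-setCol-at M c v i k = setCol-off M c v (suc i) (punchInᵢ≢i c k)

minor-setCol-off : ∀ {n} (M : Matrix (suc n)) {j c} v (j≢c : j ≢ c) →
  minor j (setCol M c v) ≐ setCol (minor j M) (punchOut j≢c) (λ i → v (suc i))
minor-setCol-off M {j} {c} v j≢c i k with k ≟ punchOut j≢c
... | inj₁ refl = trans (cong (setCol M c v (suc i)) (punchIn-punchOut j≢c))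
                       (trans (setCol-at M c v (suc i)) (sym (setCol-at (minor j M) k _ i)))
... | inj₂ k≢c'  = trans (setCol-off M c v (suc i) punchIn≢c) (sym (setCol-off (minor j M) _ _ i k≢c'))
  where punchIn≢c : punchIn j k ≢ c
        punchIn≢c eq = k≢c' (punchIn-injective j k _ (trans eq (sym (punchIn-punchOut j≢c))))

det-linear : ∀ n (M : Matrix n) c (u v : Fin n → ℤ) l →
  det n (setCol M c (λ i → u i + l * v i)) ≡ det n (setCol M c u) + l * det n (setCol M c v)
det-linear (suc n) M c u v l =
  trans (∑-cong (suc n) term-linear) (∑-linear (suc n) (term u) (term v) l)
  where
  term : (Fin (suc n) → ℤ) → Fin (suc n) → ℤ
  term w j = sign j * setCol M c w zero j * det n (minor j (setCol M c w))
  term-linear : ∀ j → term (λ i → u i + l * v i) j ≡ term u j + l * term v j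
  term-linear j with j ≟ c
  ... | inj₁ refl = trans (term-at (λ i → u i + l * v i))
                         (trans (term-linear-in-entry (sign j) (u zero) (v zero) (det n (minor j M)) l)
                                (sym (cong₂ (λ x y → x + l * y) (term-at u) (term-at v))))
    where
    term-at : ∀ w → term w j ≡ sign j * w zero * det n (minor j M)
    term-at w = cong₂ (λ x d → sign j * x * d) (setCol-at M j w zero) (det-cong n (minor-setCol-at M j w))
  ... | inj₂ j≢c = trans (term-off (λ i → u i + l * v i))
                       (trans (cong (sign j * M zero j *_) (det-linear n (minor j M) (punchOut j≢c) _ _ l))
                       (trans (distrib (sign j * M zero j) _ _ l)
                              (sym (cong₂ (λ x y → x + l * y) (term-off u) (term-off v)))))
    where
    term-off : ∀ w → term w j ≡ sign j * M zero j * det n (setCol (minor j M) (punchOut j≢c) (λ i → w (suc i)))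
    term-off w = cong₂ (λ x d → sign j * x * d) (setCol-off M c w zero j≢c) (det-cong n (minor-setCol-off M w j≢c))
    distrib : ∀ s a b l → s * (a + l * b) ≡ s * a + l * (s * b)
    distrib = solve-∀

det-additive : ∀ n (M : Matrix n) c (u v : Fin n → ℤ) →
  det n (setCol M c (λ i → u i + v i)) ≡ det n (setCol M c u) + det n (setCol M c v)
det-additive n M c u v =
  trans (det-cong n (setCol-cong M c (λ i → cong (λ s → u i + s) (sym (ℤ.*-identityˡ (v i))))))
        (trans (det-linear n M c u v 1ℤ) (cong (λ s → det n (setCol M c u) + s) (ℤ.*-identityˡ _)))

data Adjacent : ∀ {n} → Fin n → Fin n → Set where
  first : ∀ {n} → Adjacent {suc (suc n)} zero (suc zero)
  next  : ∀ {n} {a b : Fin n} → Adjacent a b → Adjacent (suc a) (suc b)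

adjacent-≢ : ∀ {n} {a b : Fin n} → Adjacent a b → a ≢ b
adjacent-≢ (next ab) eq = adjacent-≢ ab (suc-injective eq)

adjacent-sign : ∀ {n} {a b : Fin n} → Adjacent a b → sign b ≡ - 1ℤ * sign a
adjacent-sign first     = refl
adjacent-sign (next ab) = cong (- 1ℤ *_) (adjacent-sign ab)

adjacent-inject₁ : ∀ {n} (c : Fin n) → Adjacent (inject₁ c) (suc c)
adjacent-inject₁ {suc n} zero    = first
adjacent-inject₁ {suc n} (suc c) = next (adjacent-inject₁ c)

∑-adjacent : ∀ {n} (f : Fin n → ℤ) {a b} → Adjacent a b → (∀ j → j ≢ a → j ≢ b → f j ≡ 0ℤ) → ∑ n f ≡ f a + f b
∑-adjacent {suc (suc n)} f first vanish =
  trans (cong (λ s → f zero + (f (suc zero) + s)) (∑-zero n _ (λ j → vanish (suc (suc j)) (λ ()) (λ ()))))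
        (cong (λ s → f zero + s) (ℤ.+-identityʳ _))
∑-adjacent {suc n} f (next ab) vanish =
  trans (cong₂ _+_ (vanish zero (λ ()) (λ ())) (∑-adjacent (λ j → f (suc j)) ab (λ j j≢a j≢b →
           vanish (suc j) (λ eq → j≢a (suc-injective eq)) (λ eq → j≢b (suc-injective eq)))))
        (ℤ.+-identityˡ _)

adjacent-punchIn : ∀ {n} {a b : Fin (suc n)} → Adjacent a b → ∀ k →
  punchIn a k ≡ punchIn b k ⊎ (punchIn a k ≡ b × punchIn b k ≡ a)
adjacent-punchIn first     zero    = inj₂ (refl , refl)
adjacent-punchIn first     (suc k) = inj₁ refl
adjacent-punchIn (next ab) zero    = inj₁ refl
adjacent-punchIn (next ab) (suc k) with adjacent-punchIn ab k
... | inj₁ eq          = inj₁ (cong suc eq)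
... | inj₂ (eqa , eqb) = inj₂ (cong suc eqa , cong suc eqb)

adjacent-punchOut : ∀ {n} {a b j : Fin (suc n)} → Adjacent a b → (j≢a : j ≢ a) (j≢b : j ≢ b) →
  Adjacent (punchOut j≢a) (punchOut j≢b)
adjacent-punchOut {j = zero}                first     j≢a j≢b = ⊥-elim (j≢a refl)
adjacent-punchOut {j = suc zero}            first     j≢a j≢b = ⊥-elim (j≢b refl)
adjacent-punchOut {suc (suc n)} {j = suc (suc j)} first j≢a j≢b = first
adjacent-punchOut {j = zero}                (next ab) j≢a j≢b = ab
adjacent-punchOut {suc n} {j = suc j}       (next ab) j≢a j≢b =
  next (adjacent-punchOut ab (λ eq → j≢a (cong suc eq)) (λ eq → j≢b (cong suc eq)))

adjacent-minor : ∀ {n} (M : Matrix (suc n)) {a b} → Adjacent a b → (∀ i → M i a ≡ M i b) → minor a M ≐ minor b M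
adjacent-minor M ab same i k with adjacent-punchIn ab k
... | inj₁ eq          = cong (M (suc i)) eq
... | inj₂ (eqa , eqb) = trans (cong (M (suc i)) eqa) (trans (sym (same (suc i))) (cong (M (suc i)) (sym eqb)))

det-adjacent-equal : ∀ n (M : Matrix n) {a b} → Adjacent a b → (∀ i → M i a ≡ M i b) → det n M ≡ 0ℤ
det-adjacent-equal (suc n) M {a} {b} ab same = trans (∑-adjacent term ab vanish) cancel
  where
  term : Fin (suc n) → ℤ
  term j = sign j * M zero j * det n (minor j M)
  vanish : ∀ j → j ≢ a → j ≢ b → term j ≡ 0ℤ
  vanish j j≢a j≢b = trans (cong (sign j * M zero j *_) (det-adjacent-equal n (minor j M)
                              (adjacent-punchOut ab j≢a j≢b) same-in-minor)) (ℤ.*-zeroʳ (sign j * M zero j))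
    where same-in-minor : ∀ i → minor j M i (punchOut j≢a) ≡ minor j M i (punchOut j≢b)
          same-in-minor i = trans (cong (M (suc i)) (punchIn-punchOut j≢a))
                            (trans (same (suc i)) (cong (M (suc i)) (sym (punchIn-punchOut j≢b))))
  opposite : ∀ s x d → s * x * d + (- 1ℤ * s) * x * d ≡ 0ℤ
  opposite = solve-∀
  term-b : term b ≡ (- 1ℤ * sign a) * M zero a * det n (minor a M)
  term-b = cong₂ (λ s (x , d) → s * x * d) (adjacent-sign ab)
             (cong₂ _,_ (sym (same zero)) (det-cong n (λ i k → sym (adjacent-minor M ab same i k))))
  cancel : term a + term b ≡ 0ℤ
  cancel = trans (cong (λ s → term a + s) term-b) (opposite (sign a) (M zero a) (det n (minor a M)))

setCols : ∀ {n} → Matrix n → Fin n → Fin n → (Fin n → ℤ) → (Fin n → ℤ) → Matrix n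
setCols M a b u v = setCol (setCol M a u) b v

-- exchanging two adjacent columns negates the determinant: expand the determinant of the
-- matrix with both columns equal to (column a + column b), which vanishes, bilinearly
det-swap-adjacent : ∀ n (M : Matrix n) {a b} → Adjacent a b →
  det n (setCols M a b (column M b) (column M a)) ≡ - det n M
det-swap-adjacent n M {a} {b} ab = isolate (sym expansion)
  where
  a≢b = adjacent-≢ ab
  D : (Fin n → ℤ) → (Fin n → ℤ) → ℤ
  D u v = det n (setCols M a b u v)
  additiveʳ : ∀ u v₁ v₂ → D u (λ i → v₁ i + v₂ i) ≡ D u v₁ + D u v₂
  additiveʳ u = det-additive n (setCol M a u) b
  additiveˡ : ∀ u₁ u₂ v → D (λ i → u₁ i + u₂ i) v ≡ D u₁ v + D u₂ v
  additiveˡ u₁ u₂ v = begin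
    D (λ i → u₁ i + u₂ i) v                                   ≡⟨ det-cong n (setCol-comm M _ v a≢b) ⟩
    det n (setCol (setCol M b v) a (λ i → u₁ i + u₂ i))       ≡⟨ det-additive n (setCol M b v) a u₁ u₂ ⟩
    det n (setCol (setCol M b v) a u₁) + det n (setCol (setCol M b v) a u₂)
      ≡⟨ sym (cong₂ _+_ (det-cong n (setCol-comm M u₁ v a≢b)) (det-cong n (setCol-comm M u₂ v a≢b))) ⟩
    D u₁ v + D u₂ v                                            ∎
    where open ≡-Reasoning
  equal : ∀ u → D u u ≡ 0ℤ
  equal u = det-adjacent-equal n (setCols M a b u u) ab λ i →
    trans (setCol-off _ b u i a≢b) (trans (setCol-at M a u i) (sym (setCol-at _ b u i)))
  original : D (column M a) (column M b) ≡ det n M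
  original = det-cong n λ i k →
    trans (setCol-cong inner b (λ i → sym (setCol-off M a (column M a) i (λ b≡a → a≢b (sym b≡a)))) i k)
          (trans (setCol-self inner b i k) (setCol-self M a i k))
    where inner = setCol M a (column M a)
  u = column M a
  v = column M b
  both = λ i → u i + v i
  expansion : 0ℤ ≡ (0ℤ + D v u) + (det n M + 0ℤ)
  expansion = begin
    0ℤ                                     ≡⟨ sym (equal both) ⟩
    D both both                            ≡⟨ additiveʳ both u v ⟩
    D both u + D both v                    ≡⟨ cong₂ _+_ (additiveˡ u v u) (additiveˡ u v v) ⟩
    (D u u + D v u) + (D u v + D v v)      ≡⟨ cong₂ (λ x y → (x + D v u) + y) (equal u) (cong₂ _+_ original (equal v)) ⟩
    (0ℤ + D v u) + (det n M + 0ℤ)          ∎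
    where open ≡-Reasoning
  isolate : ∀ {X Y} → (0ℤ + X) + (Y + 0ℤ) ≡ 0ℤ → X ≡ - Y
  isolate {X} {Y} eq = trans (rearrange X Y) (trans (cong (_- Y) eq) (ℤ.+-identityˡ (- Y)))
    where rearrange : ∀ X Y → X ≡ ((0ℤ + X) + (Y + 0ℤ)) - Y
          rearrange = solve-∀

neg≡0 : ∀ {x} → - x ≡ 0ℤ → x ≡ 0ℤ
neg≡0 {x} -x≡0 = trans (sym (ℤ.neg-involutive x)) (cong -_ -x≡0)

-- equal columns a and suc c, where toℕ c = d + toℕ a: exchanging column suc c with its left
-- neighbour brings the two equal columns closer, until they are adjacent
det-equal-at-distance : ∀ {n} d (M : Matrix (suc n)) (a : Fin (suc n)) (c : Fin n) →
  toℕ c ≡ d ℕ.+ toℕ a → (∀ i → M i a ≡ M i (suc c)) → det (suc n) M ≡ 0ℤ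
det-equal-at-distance zero M a c c≈a same =
  det-adjacent-equal _ M (subst (λ x → Adjacent x (suc c)) c≡a (adjacent-inject₁ c)) same
  where c≡a : inject₁ c ≡ a
        c≡a = toℕ-injective (trans (toℕ-inject₁ c) c≈a)
det-equal-at-distance (suc d) M a zero () same
det-equal-at-distance {suc n} (suc d) M a (suc c) c≈a same =
  neg≡0 (trans (sym (det-swap-adjacent _ M neighbours)) (det-equal-at-distance d M′ a (inject₁ c) c′≈a same′))
  where
  b  = suc (suc c)
  b′ = suc (inject₁ c)
  neighbours : Adjacent b′ b
  neighbours = adjacent-inject₁ (suc c)
  M′ = setCols M b′ b (column M b) (column M b′)
  c′≈a : toℕ (inject₁ c) ≡ d ℕ.+ toℕ a
  c′≈a = trans (toℕ-inject₁ c) (ℕ.suc-injective c≈a)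
  a≢b′ : a ≢ b′
  a≢b′ a≡b′ = ℕ.m≢1+n+m (toℕ a) (trans (cong toℕ a≡b′) (cong suc c′≈a))
  a≢b : a ≢ b
  a≢b a≡b = ℕ.m≢1+n+m (toℕ a) (trans (cong toℕ a≡b) (cong suc c≈a))
  same′ : ∀ i → M′ i a ≡ M′ i b′
  same′ i = begin
    M′ i a   ≡⟨ setCol-off _ b _ i a≢b ⟩
    setCol M b′ (column M b) i a ≡⟨ setCol-off M b′ _ i a≢b′ ⟩
    M i a    ≡⟨ same i ⟩
    M i b    ≡⟨ sym (setCol-at M b′ (column M b) i) ⟩
    setCol M b′ (column M b) i b′ ≡⟨ sym (setCol-off _ b _ i (adjacent-≢ neighbours)) ⟩
    M′ i b′  ∎
    where open ≡-Reasoning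

det-equal-ordered : ∀ {n} (M : Matrix n) a b → toℕ a ℕ.< toℕ b → (∀ i → M i a ≡ M i b) → det n M ≡ 0ℤ
det-equal-ordered {suc n} M a (suc c) a<b same =
  det-equal-at-distance _ M a c (sym (ℕ.m∸n+n≡m (ℕ.s≤s⁻¹ a<b))) same

det-equal-columns : ∀ n (M : Matrix n) {a b} → a ≢ b → (∀ i → M i a ≡ M i b) → det n M ≡ 0ℤ
det-equal-columns n M {a} {b} a≢b same with ℕ.<-cmp (toℕ a) (toℕ b)
... | tri< a<b _ _ = det-equal-ordered M a b a<b same
... | tri≈ _ a≈b _ = ⊥-elim (a≢b (toℕ-injective a≈b))
... | tri> _ _ b<a = det-equal-ordered M b a b<a (λ i → sym (same i))

det-add-column : ∀ n (M : Matrix n) {a b} l → a ≢ b →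
  det n (setCol M a (λ i → M i a + l * M i b)) ≡ det n M
det-add-column n M {a} {b} l a≢b = begin
  det n (setCol M a (λ i → M i a + l * M i b))
    ≡⟨ det-linear n M a (column M a) (column M b) l ⟩
  det n (setCol M a (column M a)) + l * det n (setCol M a (column M b))
    ≡⟨ cong₂ (λ x y → x + l * y) (det-cong n (setCol-self M a)) repeated ⟩
  det n M + l * 0ℤ
    ≡⟨ trans (cong (λ y → det n M + y) (ℤ.*-zeroʳ l)) (ℤ.+-identityʳ _) ⟩
  det n M ∎
  where
  open ≡-Reasoning
  repeated : det n (setCol M a (column M b)) ≡ 0ℤ
  repeated = det-equal-columns n _ a≢b λ i →
    trans (setCol-at M a _ i) (sym (setCol-off M a _ i (λ b≡a → a≢b (sym b≡a))))

shear : ∀ {m} → (Fin m → ℤ) → Matrix (suc m) → Matrix (suc m)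
shear coeffs M i zero    = M i zero
shear coeffs M i (suc k) = M i (suc k) + coeffs k * M i zero

shear-cong : ∀ {m} (M : Matrix (suc m)) {c d : Fin m → ℤ} → (∀ k → c k ≡ d k) → shear c M ≐ shear d M
shear-cong M c≡d i zero    = refl
shear-cong M c≡d i (suc k) = cong (λ x → M i (suc k) + x * M i zero) (c≡d k)

below : ∀ {m} → ℕ → (Fin m → ℤ) → Fin m → ℤ
below t coeffs k with toℕ k ℕ.<? t
... | yes _ = coeffs k
... | no  _ = 0ℤ

below-< : ∀ {m t} (coeffs : Fin m → ℤ) {k} → toℕ k ℕ.< t → below t coeffs k ≡ coeffs k
below-< {t = t} coeffs {k} k<t with toℕ k ℕ.<? t
... | yes _   = refl
... | no  k≮t = ⊥-elim (k≮t k<t)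

below-≮ : ∀ {m t} (coeffs : Fin m → ℤ) {k} → ¬ toℕ k ℕ.< t → below t coeffs k ≡ 0ℤ
below-≮ {t = t} coeffs {k} k≮t with toℕ k ℕ.<? t
... | yes k<t = ⊥-elim (k≮t k<t)
... | no  _   = refl

below-suc : ∀ {m t} (coeffs : Fin m → ℤ) {k} → toℕ k ≢ t → below (suc t) coeffs k ≡ below t coeffs k
below-suc {t = t} coeffs {k} k≢t with toℕ k ℕ.<? t
... | yes k<t = below-< coeffs (ℕ.m<n⇒m<1+n k<t)
... | no  k≮t = below-≮ coeffs (λ k<1+t → k≮t (ℕ.≤∧≢⇒< (ℕ.s≤s⁻¹ k<1+t) k≢t))

det-shear-below : ∀ {m} (coeffs : Fin m → ℤ) (M : Matrix (suc m)) t → t ℕ.≤ m →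
  det (suc m) (shear (below t coeffs) M) ≡ det (suc m) M
det-shear-below {m} coeffs M zero _ = det-cong (suc m) unchanged
  where unchanged : shear (below 0 coeffs) M ≐ M
        unchanged i zero    = refl
        unchanged i (suc k) = trans (cong (λ x → M i (suc k) + x * M i zero) (below-≮ {t = 0} coeffs {k} (λ ())))
                                    (ℤ.+-identityʳ _)
det-shear-below {m} coeffs M (suc t) t<m = begin
  det (suc m) (shear (below (suc t) coeffs) M)   ≡⟨ det-cong (suc m) one-more ⟩
  det (suc m) (setCol S (suc f) added)            ≡⟨ det-add-column (suc m) S {suc f} {zero} (coeffs f) (λ ()) ⟩
  det (suc m) S                                   ≡⟨ det-shear-below coeffs M t (ℕ.<⇒≤ t<m) ⟩
  det (suc m) M                                   ∎
  where
  open ≡-Reasoning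
  S = shear (below t coeffs) M
  f = fromℕ< t<m
  f≈t : toℕ f ≡ t
  f≈t = toℕ-fromℕ< t<m
  added = λ i → S i (suc f) + coeffs f * S i zero
  one-more : shear (below (suc t) coeffs) M ≐ setCol S (suc f) added
  one-more i zero = sym (setCol-off S (suc f) added i {zero} (λ ()))
  one-more i (suc k) with k ≟ f
  ... | inj₁ refl = begin
    M i (suc k) + below (suc t) coeffs k * M i zero  ≡⟨ cong (λ x → M i (suc k) + x * M i zero) (below-< coeffs k<1+t) ⟩
    M i (suc k) + coeffs k * M i zero                ≡⟨ cong (λ x → x + coeffs k * M i zero) (sym (ℤ.+-identityʳ (M i (suc k)))) ⟩
    (M i (suc k) + 0ℤ * M i zero) + coeffs k * M i zero
      ≡⟨ cong (λ x → (M i (suc k) + x * M i zero) + coeffs k * M i zero) (sym (below-≮ coeffs k≮t)) ⟩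
    added i                                           ≡⟨ sym (setCol-at S (suc k) added i) ⟩
    setCol S (suc k) added i (suc k)                  ∎
    where k<1+t = ℕ.≤-reflexive (cong suc f≈t)
          k≮t = λ k<t → ℕ.<-irrefl f≈t k<t
  ... | inj₂ k≢f  = trans (cong (λ x → M i (suc k) + x * M i zero)
                                (below-suc coeffs (λ k≈t → k≢f (toℕ-injective (trans k≈t (sym f≈t))))))
                          (sym (setCol-off S (suc f) added i (λ eq → k≢f (suc-injective eq))))

det-shear : ∀ {m} (coeffs : Fin m → ℤ) (M : Matrix (suc m)) → det (suc m) (shear coeffs M) ≡ det (suc m) M
det-shear {m} coeffs M =
  trans (det-cong (suc m) (shear-cong M (λ k → sym (below-< coeffs (toℕ<n k)))))
        (det-shear-below coeffs M m ℕ.≤-refl)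

det-first-row-unit : ∀ n (M : Matrix (suc n)) → (∀ k → M zero (suc k) ≡ 0ℤ) →
  det (suc n) M ≡ M zero zero * det n (minor zero M)
det-first-row-unit n M row≡0 =
  trans (cong (λ s → 1ℤ * M zero zero * det n (minor zero M) + s) (∑-zero n _ vanish))
        (leading (M zero zero) (det n (minor zero M)))
  where
  vanish : ∀ j → sign (suc j) * M zero (suc j) * det n (minor (suc j) M) ≡ 0ℤ
  vanish j = trans (cong (λ x → sign (suc j) * x * det n (minor (suc j) M)) (row≡0 j))
                   (through-zero (sign (suc j)) (det n (minor (suc j) M)))
    where through-zero : ∀ s d → s * 0ℤ * d ≡ 0ℤ
          through-zero = solve-∀
  leading : ∀ x d → 1ℤ * x * d + 0ℤ ≡ x * d
  leading = solve-∀

setFirstRow : ∀ {n} → (Fin n → ℤ) → Matrix n → Matrix n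
setFirstRow r M zero    k = r k
setFirstRow r M (suc i) k = M (suc i) k

det-linear-first-row : ∀ n (M : Matrix (suc n)) (r s : Fin (suc n) → ℤ) l →
  det (suc n) (setFirstRow (λ k → r k + l * s k) M) ≡ det (suc n) (setFirstRow r M) + l * det (suc n) (setFirstRow s M)
det-linear-first-row n M r s l =
  trans (∑-cong (suc n) (λ j → term-linear-in-entry (sign j) (r j) (s j) (det n (minor j M)) l))
        (∑-linear (suc n) (λ j → sign j * r j * det n (minor j M)) (λ j → sign j * s j * det n (minor j M)) l)

δ : ∀ {n} → Fin n → Fin n → ℤ
δ zero    zero    = 1ℤ
δ zero    (suc _) = 0ℤ
δ (suc _) zero    = 0ℤ
δ (suc i) (suc k) = δ i k

δ-diagonal : ∀ {n} (i : Fin n) → δ i i ≡ 1ℤ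
δ-diagonal zero    = refl
δ-diagonal (suc i) = δ-diagonal i

δ-off-diagonal : ∀ {n} (i k : Fin n) → i ≢ k → δ i k ≡ 0ℤ
δ-off-diagonal zero    zero    i≢k = ⊥-elim (i≢k refl)
δ-off-diagonal zero    (suc k) _   = refl
δ-off-diagonal (suc i) zero    _   = refl
δ-off-diagonal (suc i) (suc k) i≢k = δ-off-diagonal i k (λ eq → i≢k (cong suc eq))

det-minus-identity : ∀ m → det m (λ i k → - δ i k) ≡ (- 1ℤ) ^ m
det-minus-identity zero    = refl
det-minus-identity (suc m) =
  trans (det-first-row-unit m (λ i k → - δ i k) (λ _ → refl)) (cong (- 1ℤ *_) (det-minus-identity m))

J-I : ∀ {n} → Matrix n
J-I i k = 1ℤ - δ i k

-- J - I with its first row replaced by ones has determinant (-1)^m: subtracting the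
-- first column (all ones) from the others leaves the first row (1, 0, …, 0) and the minor -I
det-ones-over-J-I : ∀ m → det (suc m) (setFirstRow (λ _ → 1ℤ) J-I) ≡ (- 1ℤ) ^ m
det-ones-over-J-I m = begin
  det (suc m) Z                               ≡⟨ sym (det-shear (λ _ → - 1ℤ) Z) ⟩
  det (suc m) (shear (λ _ → - 1ℤ) Z)          ≡⟨ det-first-row-unit m (shear (λ _ → - 1ℤ) Z) (λ _ → refl) ⟩
  1ℤ * det m (minor zero (shear (λ _ → - 1ℤ) Z)) ≡⟨ ℤ.*-identityˡ _ ⟩
  det m (minor zero (shear (λ _ → - 1ℤ) Z))    ≡⟨ det-cong m (λ i k → cancel (δ i k)) ⟩
  det m (λ i k → - δ i k)                      ≡⟨ det-minus-identity m ⟩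
  (- 1ℤ) ^ m                                   ∎
  where
  open ≡-Reasoning
  Z = setFirstRow (λ _ → 1ℤ) J-I
  cancel : ∀ d → (1ℤ - d) + - 1ℤ * 1ℤ ≡ - d
  cancel = solve-∀

-- det(J - I) = (-1)^m · m for size m + 1, by expanding the first row (0, 1, …, 1) as
-- (1, …, 1) - (1, 0, …, 0), which gives det(J-I)ₘ₊₂ = (-1)^(m+1) - det(J-I)ₘ₊₁
det-J-I : ∀ m → det (suc m) J-I ≡ (- 1ℤ) ^ m * + m
det-J-I zero    = refl
det-J-I (suc m) = begin
  det (suc (suc m)) J-I
    ≡⟨ det-cong (suc (suc m)) first-row-split ⟩
  det (suc (suc m)) (setFirstRow (λ k → 1ℤ + - 1ℤ * δ zero k) J-I)
    ≡⟨ det-linear-first-row (suc m) J-I (λ _ → 1ℤ) (δ zero) (- 1ℤ) ⟩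
  det (suc (suc m)) (setFirstRow (λ _ → 1ℤ) J-I) + - 1ℤ * det (suc (suc m)) (setFirstRow (δ zero) J-I)
    ≡⟨ cong₂ (λ x y → x + - 1ℤ * y) (det-ones-over-J-I (suc m))
             (trans (det-first-row-unit (suc m) (setFirstRow (δ zero) J-I) (λ _ → refl)) (ℤ.*-identityˡ _)) ⟩
  (- 1ℤ) ^ suc m + - 1ℤ * det (suc m) J-I
    ≡⟨ cong (λ d → (- 1ℤ) ^ suc m + - 1ℤ * d) (det-J-I m) ⟩
  - 1ℤ * (- 1ℤ) ^ m + - 1ℤ * ((- 1ℤ) ^ m * + m)
    ≡⟨ collect ((- 1ℤ) ^ m) (+ m) ⟩
  - 1ℤ * (- 1ℤ) ^ m * (1ℤ + + m)
    ≡⟨ cong (λ x → - 1ℤ * (- 1ℤ) ^ m * x) (sym (ℤ.pos-+ 1 m)) ⟩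
  (- 1ℤ) ^ suc m * + suc m ∎
  where
  open ≡-Reasoning
  first-row-split : J-I ≐ setFirstRow (λ k → 1ℤ + - 1ℤ * δ zero k) J-I
  first-row-split zero    k = cong (λ x → 1ℤ + x) (sym (ℤ.-1*i≡-i (δ zero k)))
  first-row-split (suc i) k = refl
  collect : ∀ s x → - 1ℤ * s + - 1ℤ * (s * x) ≡ - 1ℤ * s * (1ℤ + x)
  collect = solve-∀

-- The matrix of symbols is J - I: on the diagonal the argument is 0, with symbol 0; off it the
-- argument j - i is not a multiple of p, as 0 ≤ i, j < p, and is a cube, so its symbol is 1.
symbol-matrix : ∀ {p n} → Prime p → p % 3 ≡ 2 → n ≤ p → (M : Matrix n) →
  (∀ i j → CubicSymbol p ((+ toℕ j - + toℕ i) + 0ℤ) (M i j)) → M ≐ J-I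
symbol-matrix {p} p-prime p≡2 n≤p M symbol i j with i ≟ j
... | inj₁ refl = trans (symbol-of-multiple p∣0 (symbol i i)) (sym (cong (λ d → 1ℤ - d) (δ-diagonal i)))
  where p∣0 : + p Unsigned.∣ ((+ toℕ i - + toℕ i) + 0ℤ)
        p∣0 = subst (λ z → p ℕ.∣ ∣ z ∣) (sym (trans (ℤ.+-identityʳ _) (ℤ.+-inverseʳ (+ toℕ i)))) (p ℕ.∣0)
... | inj₂ i≢j = trans (symbol-of-unit all-cubes p∤j-i (symbol i j)) (sym (cong (λ d → 1ℤ - d) (δ-off-diagonal i j i≢j)))
  where
  all-cubes : ∀ a → CubeSolvable p a
  all-cubes a with cube-root p-prime p≡2 a
  ... | r , p∣r³-a = r , ∣⇒∣ᵤ p∣r³-a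
  below-p : ∀ k → toℕ k ℕ.< p
  below-p k = ℕ.<-≤-trans (toℕ<n k) n≤p
  p∤j-i : ¬ + p Unsigned.∣ ((+ toℕ j - + toℕ i) + 0ℤ)
  p∤j-i p∣ = distinct-incongruent (below-p i) (below-p j) (λ eq → i≢j (toℕ-injective eq))
               (subst (λ z → p ℕ.∣ ∣ z ∣) (ℤ.+-identityʳ (+ toℕ j - + toℕ i)) p∣)

theorem3p1 : (p : ℕ) → Prime p → p % 2 ≡ 1 → p % 3 ≡ 2 →
    (c : ℤ) → c ≡ 0ℤ →
    (n : ℕ) → 1 ≤ n → n ≤ p →
    (M : Fin n → Fin n → ℤ) →
    (∀ i j → CubicSymbol p ((+ toℕ j - + toℕ i) + c) (M i j)) →
    det n M ≡ ((- 1ℤ) ^ (n ∸ 1)) * + (n ∸ 1)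
theorem3p1 p p-prime _ p≡2 .0ℤ refl (suc m) (s≤s z≤n) n≤p M symbol =
  trans (det-cong (suc m) (symbol-matrix p-prime p≡2 n≤p M symbol)) (det-J-I m)
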